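{- Let $G$ be a finite simple graph and $f\colon V(G)\to\mathbb{N}$. If $G$ is weak$^*$ $f$-degenerate, then $G$ is DP-$f$-paintable. In particular, $\chi_{DPP}(G)\le wd^*(G)$.
   Context: $\mathbb{N}=\{0,1,2,\dots\}$. Weak$^*$ degeneracy: for pairs $(G,f)$ with $f\colon V(G)\to\mathbb{N}$, define operations (1) $\mathsf{ReduceValue}_{x,s}(G,f)=(G,f')$, $f'$ equal to $f$ except $f'(x)=f(x)-s$ ($s$ a positive integer), legal if $f(x)>s$; (2) $\mathsf{EdgeDelete}_{(x,y)}(G,f)=(G-xy,f')$ for an edge $xy$, $f'$ equal to $f$ except $f'(x)=f(x)-f(y)$, legal if $f(x)>f(y)$; (3) $\mathsf{VertexDelete}_x(G,f)=(G-x,f')$ where $f'(v)=f(v)-1$ for neighbours $v$ of $x$ and $f'(v)=f(v)$ for other $v\ne x$, legal if $f(x)>0$. $G$ is weak$^*$ $f$-degenerate if some finite sequence of legal operations transforms $(G,f)$ into the empty graph (no vertices). The weak$^*$ degeneracy $wd^*(G)$ is the least integer $d$ such that $G$ is weak$^*$ $d$-degenerate (with $d$ the constant function). Covers: a cover of $G$ is a pair $(L,M)$ where $L=\{L(v)\}_{v\in V(G)}$ are pairwise disjoint sets and for each edge $e=uv$, $M_e$ is a bipartite graph with parts $L(u),L(v)$; it is simple if each $M_e$ is a matching. A partial $(L,M)$-colouring is a map $\phi$ defined on some $W\subseteq V(G)$ with $\phi(v)\in L(v)$ and $\phi(u)\phi(v)\notin E(M_{uv})$ for every edge $uv$ with $u,v\in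 W$. DP-$f$-painting game: initially each vertex $v$ has $f(v)$ tokens and is uncoloured. In each round Lister chooses a simple cover $(L_i,M_i)$ of the graph induced by the uncoloured vertices and removes $|L_i(v)|$ tokens from each vertex $v$; Painter then chooses a partial $(L_i,M_i)$-colouring, colouring some set of these vertices. Painter wins if all vertices get coloured; Lister wins if some uncoloured vertex has no tokens left. $G$ is DP-$f$-paintable if Painter has a winning strategy. The DP-paint number $\chi_{DPP}(G)$ is the least $k$ such that $G$ is DP-$k$-paintable. -}

module Defs where

open import Data.Nat using (ℕ; zero; suc; _≤_; _<_; _∸_)
open import Data.Fin using (Fin; _≟_)
open import Data.Bool using (Bool; true; false; if_then_else_; _∧_; _∨_; not)
open import Data.Maybe using (Maybe; just; nothing)
open import Data.Product using (Σ; _×_; _,_)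
open import Relation.Nullary using (¬_; does)
open import Relation.Binary.PropositionalEquality using (_≡_)

record SimpleGraph (n : ℕ) : Set where
  field
    Adj    : Fin n → Fin n → Bool
    sym    : ∀ u v → Adj u v ≡ Adj v u
    irrefl : ∀ v → Adj v v ≡ false
open SimpleGraph public

_==_ : ∀ {n} → Fin n → Fin n → Bool
u == v = does (u ≟ v)

upd : ∀ {n} {A : Set} → (Fin n → A) → Fin n → A → Fin n → A
upd f x a v = if v == x then a else f v

-- Weak* degeneracy.
-- A state is (alive, E, f): the current graph has vertex set
-- {v | alive v ≡ true} and edges {uv | both alive, E u v ≡ true}.

delEdge : ∀ {n} → (Fin n → Fin n → Bool) → Fin n → Fin n → Fin n → Fin n → Bool
delEdge E x y u v = E u v ∧ not (((u == x) ∧ (v == y)) ∨ ((u == y) ∧ (v == x)))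

data WStar {n : ℕ} (alive : Fin n → Bool) (E : Fin n → Fin n → Bool)
           (f : Fin n → ℕ) : Set where
  empty  : (∀ v → alive v ≡ false) → WStar alive E f
  reduceValue : (x : Fin n) (s : ℕ) → alive x ≡ true → 1 ≤ s → s < f x →
           WStar alive E (upd f x (f x ∸ s)) → WStar alive E f
  edgeDelete : (x y : Fin n) → alive x ≡ true → alive y ≡ true → E x y ≡ true →
           f y < f x →
           WStar alive (delEdge E x y) (upd f x (f x ∸ f y)) → WStar alive E f
  vertexDelete : (x : Fin n) → alive x ≡ true → 0 < f x →
           WStar (upd alive x false) E
                 (λ v → if alive v ∧ E x v then f v ∸ 1 else f v) →
           WStar alive E f

WeakStarDegenerate : ∀ {n} → SimpleGraph n → (Fin n → ℕ) → Set
WeakStarDegenerate G f = WStar (λ _ → true) (Adj G) f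

-- DP-painting game.
-- State: U = set of uncoloured vertices, t = remaining tokens.

-- A simple cover of G[U] chosen by Lister, with |L(v)| ≤ t v.
-- L(v) is represented by Fin (size v) (tagged by v, hence pairwise disjoint);
-- M u v a b ≡ true means a ∈ L(u) and b ∈ L(v) are adjacent in M_{uv}.
record Cover {n : ℕ} (G : SimpleGraph n) (U : Fin n → Bool) (t : Fin n → ℕ) : Set where
  field
    size     : Fin n → ℕ
    outside  : ∀ v → U v ≡ false → size v ≡ 0
    enough   : ∀ v → size v ≤ t v
    M        : (u v : Fin n) → Fin (size u) → Fin (size v) → Bool
    M-sym    : ∀ u v a b → M u v a b ≡ M v u b a
    match₁   : ∀ u v → Adj G u v ≡ true → ∀ a b b' →
               M u v a b ≡ true → M u v a b' ≡ true → b ≡ b'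
    match₂   : ∀ u v → Adj G u v ≡ true → ∀ a a' b →
               M u v a b ≡ true → M u v a' b ≡ true → a ≡ a'
open Cover public

-- Lister must remove at least one token in a round (otherwise the round is void).
Nontrivial : ∀ {n} {G : SimpleGraph n} {U t} → Cover G U t → Set
Nontrivial {n} c = Σ (Fin n) λ v → 1 ≤ size c v

PartialColouring : ∀ {n} {G : SimpleGraph n} {U t} → Cover G U t → Set
PartialColouring {n} {G} c =
  Σ ((v : Fin n) → Maybe (Fin (size c v))) λ φ →
    ∀ u v → Adj G u v ≡ true → ∀ a b →
      φ u ≡ just a → φ v ≡ just b → ¬ (M c u v a b ≡ true)

isJust : ∀ {A : Set} → Maybe A → Bool
isJust (just _) = true
isJust nothing  = false

data PainterWins {n : ℕ} (G : SimpleGraph n) : (Fin n → Bool) → (Fin n → ℕ) → Set where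
  allColoured : ∀ {U t} → (∀ v → U v ≡ false) → PainterWins G U t
  round : ∀ {U t} →
    -- Lister has not (yet) won: every uncoloured vertex still has a token
    (∀ v → U v ≡ true → 0 < t v) →
    ((c : Cover G U t) → Nontrivial c →
       Σ (PartialColouring c) λ φc →
         PainterWins G (λ v → U v ∧ not (isJust (Data.Product.proj₁ φc v)))
                       (λ v → t v ∸ size c v)) →
    PainterWins G U t

DPPaintable : ∀ {n} → SimpleGraph n → (Fin n → ℕ) → Set
DPPaintable G f = PainterWins G (λ _ → true) f

IsWdStar : ∀ {n} → SimpleGraph n → ℕ → Set
IsWdStar G d = WeakStarDegenerate G (λ _ → d) ×
               (∀ d' → WeakStarDegenerate G (λ _ → d') → d ≤ d')

IsChiDPP : ∀ {n} → SimpleGraph n → ℕ → Set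
IsChiDPP G k = DPPaintable G (λ _ → k) ×
               (∀ k' → DPPaintable G (λ _ → k') → k ≤ k')

module Submission where

-- Induct on the sequence of weak* operations. Each operation turns (G, f) into (G', f'), and a
-- winning Painter strategy on (G', f') is turned into one on (G, f) by simulation: Lister's cover
-- of G is restricted to a cover of G' that fits the simulated tokens, and Painter's answer there
-- is pulled back. For ReduceValue the lists are merely truncated. For EdgeDelete (x, y), x drops
-- the colours matched into L(y); there are at most |L(y)| of them, and while y is uncoloured these
-- are paid for by the f(y) tokens x gave up, which also makes the pulled-back colouring proper
-- across xy. For VertexDelete x, Painter waits until Lister first offers x a colour a, colours x
-- with a, and drops from each neighbour the at most one colour matched to a, paid for by the
-- token the neighbour lost. The simulation is well founded on Lister's total number of tokens.

open import Defs hiding (sym)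
open import Data.Nat using (ℕ; zero; suc; _≤_; _<_; _∸_; _+_; _⊓_; _⊔_; z≤n; s≤s)
open import Data.Nat.Properties hiding (_≟_; suc-injective; 0≢1+n)
open import Data.Nat.Induction using (<-wellFounded)
open import Data.Fin using (Fin; zero; suc; inject≤; punchOut; _≟_)
open import Data.Fin.Properties
  using (¬Fin0; 0≢1+n; suc-injective; inject≤-injective; lift-injective; punchOut-injective; any?)
open import Data.Bool using (Bool; true; false; if_then_else_; _∧_; _∨_; not)
open import Data.Bool.Properties as Bool
  using (∧-comm; ∨-comm; ∧-identityʳ; ∧-zeroʳ; ∧-conicalˡ; not-injective)
open import Data.Maybe as Maybe using (Maybe; just; nothing)
open import Data.Product using (Σ; ∃; _×_; _,_; proj₁; proj₂; map₂; uncurry)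
open import Data.Sum using (_⊎_; inj₁; inj₂)
open import Data.Empty using (⊥-elim)
open import Function using (_∘_; _↣_; Injection; mk↣)
open import Function.Construct.Identity using (↣-id)
open import Induction.WellFounded using (Acc; acc)
open import Relation.Nullary using (¬_; Dec; yes; no; contradiction)
open import Relation.Nullary.Decidable using (dec-true; dec-false; _×-dec_)
open import Relation.Unary using (Decidable)
open import Relation.Binary.PropositionalEquality

open Injection using (to; injective)

==-refl : ∀ {n} (x : Fin n) → (x == x) ≡ true
==-refl x = dec-true (x ≟ x) refl

==⇒≡ : ∀ {n} {u v : Fin n} → (u == v) ≡ true → u ≡ v
==⇒≡ {u = u} {v} eq with u ≟ v | eq
... | yes u≡v | _ = u≡v

upd-≡ : ∀ {n} {A : Set} (f : Fin n → A) x a → upd f x a x ≡ a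
upd-≡ f x a rewrite ==-refl x = refl

upd-≢ : ∀ {n} {A : Set} (f : Fin n → A) x a {v} → v ≢ x → upd f x a v ≡ f v
upd-≢ f x a v≢x rewrite dec-false (_ ≟ x) v≢x = refl

isJust-map : ∀ {A B : Set} (f : A → B) (m : Maybe A) → isJust (Maybe.map f m) ≡ isJust m
isJust-map f (just _) = refl
isJust-map f nothing  = refl

map≡just : ∀ {A B : Set} {f : A → B} (m : Maybe A) {b} →
           Maybe.map f m ≡ just b → ∃ λ a → m ≡ just a × f a ≡ b
map≡just (just a) refl = a , refl , refl

∨-∧-true : ∀ a b c d → (a ∧ b) ∨ (c ∧ d) ≡ true → (a ≡ true × b ≡ true) ⊎ (c ≡ true × d ≡ true)
∨-∧-true true  true  _     _     _  = inj₁ (refl , refl)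
∨-∧-true _     _     true  true  _  = inj₂ (refl , refl)
∨-∧-true true  false true  false ()
∨-∧-true true  false false _     ()
∨-∧-true false _     true  false ()
∨-∧-true false _     false _     ()

if-≤ : ∀ b {m} → (if b then m else 0) ≤ m
if-≤ true  = ≤-refl
if-≤ false = z≤n

m∸[n⊓m]≡m∸n : ∀ m n → m ∸ (n ⊓ m) ≡ m ∸ n
m∸[n⊓m]≡m∸n m n = begin
  m ∸ (n ⊓ m)         ≡⟨ ∸-distribˡ-⊓-⊔ m n m ⟩
  (m ∸ n) ⊔ (m ∸ m)   ≡⟨ cong ((m ∸ n) ⊔_) (n∸n≡0 m) ⟩
  (m ∸ n) ⊔ 0         ≡⟨ ⊔-identityʳ (m ∸ n) ⟩
  m ∸ n               ∎
  where open ≡-Reasoning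

m≤n∸r⇒m∸k≤n∸o : ∀ {m n r o} k → m ≤ n ∸ r → o ≤ k + r → m ∸ k ≤ n ∸ o
m≤n∸r⇒m∸k≤n∸o {m} {n} {r} {o} k m≤n∸r o≤k+r = begin
  m ∸ k        ≤⟨ ∸-monoˡ-≤ k m≤n∸r ⟩
  n ∸ r ∸ k    ≡⟨ ∸-+-assoc n r k ⟩
  n ∸ (r + k)  ≤⟨ ∸-monoʳ-≤ n (≤-trans o≤k+r (≤-reflexive (+-comm k r))) ⟩
  n ∸ o        ∎
  where open ≤-Reasoning

m∸n+[o∸p]≡m+o∸[n+p] : ∀ {m n o p} → n ≤ m → p ≤ o → m ∸ n + (o ∸ p) ≡ m + o ∸ (n + p)
m∸n+[o∸p]≡m+o∸[n+p] {m} {n} {o} {p} n≤m p≤o = begin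
  m ∸ n + (o ∸ p)    ≡⟨ +-∸-assoc (m ∸ n) p≤o ⟨
  m ∸ n + o ∸ p      ≡⟨ cong (_∸ p) (+-∸-comm o n≤m) ⟨
  m + o ∸ n ∸ p      ≡⟨ ∸-+-assoc (m + o) n p ⟩
  m + o ∸ (n + p)    ∎
  where open ≡-Reasoning

if-∧-∸-≤ : ∀ a b m s → (if a ∧ b then m ∸ s else 0) ≤ (if a then m else 0) ∸ s
if-∧-∸-≤ true  true  _ _ = ≤-refl
if-∧-∸-≤ true  false _ _ = z≤n
if-∧-∸-≤ false _     _ _ = z≤n

total : ∀ {n} → (Fin n → ℕ) → ℕ
total {zero}  t = 0
total {suc n} t = t zero + total (t ∘ suc)

total-mono-≤ : ∀ {n} {s t : Fin n → ℕ} → (∀ v → s v ≤ t v) → total s ≤ total t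
total-mono-≤ {zero}  _   = z≤n
total-mono-≤ {suc n} s≤t = +-mono-≤ (s≤t zero) (total-mono-≤ (s≤t ∘ suc))

total-mono-< : ∀ {n} {s t : Fin n → ℕ} → (∀ v → s v ≤ t v) → ∀ w → s w < t w → total s < total t
total-mono-< s≤t zero    sw<tw = +-mono-<-≤ sw<tw (total-mono-≤ (s≤t ∘ suc))
total-mono-< s≤t (suc w) sw<tw = +-mono-≤-< (s≤t zero) (total-mono-< (s≤t ∘ suc) w sw<tw)

StateRelation : ℕ → Set₁
StateRelation n = (U : Fin n → Bool) (t : Fin n → ℕ) (U' : Fin n → Bool) (t' : Fin n → ℕ) → Set

Solvent : ∀ {n} → (Fin n → Bool) → (Fin n → ℕ) → Set
Solvent U t = ∀ v → U v ≡ true → 0 < t v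

module _ {n} {G : SimpleGraph n} where

  uncolouredAfter : ∀ {U t} (c : Cover G U t) → PartialColouring c → Fin n → Bool
  uncolouredAfter {U} c (φ , _) v = U v ∧ not (isJust (φ v))

  tokensAfter : ∀ {U t} → Cover G U t → Fin n → ℕ
  tokensAfter {t = t} c v = t v ∸ size c v

  tokensAfter-decreases : ∀ {U t} (c : Cover G U t) → Nontrivial c → total (tokensAfter c) < total t
  tokensAfter-decreases {t = t} c (w , nonempty) =
    total-mono-< (λ v → m∸n≤m (t v) (size c v)) w (∸-monoʳ-< nonempty (enough c w))

  WinningReply : ∀ {U t} → Cover G U t → Set
  WinningReply c = Σ (PartialColouring c) λ φ → PainterWins G (uncolouredAfter c φ) (tokensAfter c)

  noColouring : ∀ {U t} (c : Cover G U t) → PartialColouring c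
  noColouring c = (λ _ → nothing) , λ { _ _ _ _ _ () _ }

  PainterWins⇒Solvent : ∀ {U t} → PainterWins G U t → Solvent U t
  PainterWins⇒Solvent (allColoured none) v uncoloured = contradiction (trans (sym (none v)) uncoloured) λ ()
  PainterWins⇒Solvent (round solvent _) = solvent

  PainterWins-cong : ∀ {U₁ t₁ U₂ t₂} → (∀ v → U₁ v ≡ U₂ v) → (∀ v → t₁ v ≡ t₂ v) →
                     PainterWins G U₁ t₁ → PainterWins G U₂ t₂
  PainterWins-cong U₁≗U₂ _ (allColoured none) = allColoured λ v → trans (sym (U₁≗U₂ v)) (none v)
  PainterWins-cong {U₁} {t₁} {U₂} {t₂} U₁≗U₂ t₁≗t₂ (round solvent moves) =
    round (λ v u → subst (0 <_) (t₁≗t₂ v) (solvent v (trans (U₁≗U₂ v) u))) reply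
    where
    retarget : Cover G U₂ t₂ → Cover G U₁ t₁
    retarget c = record
      { size = size c ; M = M c ; M-sym = M-sym c ; match₁ = match₁ c ; match₂ = match₂ c
      ; outside = λ v out → outside c v (trans (sym (U₁≗U₂ v)) out)
      ; enough = λ v → subst (size c v ≤_) (sym (t₁≗t₂ v)) (enough c v)
      }
    reply : (c : Cover G U₂ t₂) → Nontrivial c → WinningReply c
    reply c nontrivial with moves (retarget c) nontrivial
    ... | φ , wins = φ , PainterWins-cong (λ v → cong (_∧ _) (U₁≗U₂ v)) (λ v → cong (_∸ size c v) (t₁≗t₂ v)) wins

Response : ∀ {n} (G G' : SimpleGraph n) → StateRelation n →
           ∀ {U t} (U' : Fin n → Bool) (t' : Fin n → ℕ) → Cover G U t → Set
Response G G' R U' t' c =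
  Σ (Cover G' U' t') λ c' → (φ' : PartialColouring c') → Σ (PartialColouring c) λ φ →
    R (uncolouredAfter c φ) (tokensAfter c) (uncolouredAfter c' φ') (tokensAfter c')

record Simulation {n} (G G' : SimpleGraph n) : Set₁ where
  field
    Related : StateRelation n
    solvent : ∀ {U t U' t'} → Related U t U' t' → Solvent U' t' → Solvent U t
    respond : ∀ {U t U' t'} → Related U t U' t' → (c : Cover G U t) → Response G G' Related U' t' c

simulate : ∀ {n} {G G' : SimpleGraph n} (S : Simulation G G') → let open Simulation S in
           ∀ {U t U' t'} → Related U t U' t' → PainterWins G' U' t' → PainterWins G U t
simulate {n} {G} {G'} S {t = t} = go (<-wellFounded (total t))
  where
  open Simulation S
  go : ∀ {U t U' t'} → Acc _<_ (total t) → Related U t U' t' → PainterWins G' U' t' → PainterWins G U t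
  go {U} {t} {U'} {t'} (acc smaller) related wins' =
    round (solvent related (PainterWins⇒Solvent wins')) reply
    where
    reply : (c : Cover G U t) → Nontrivial c → WinningReply c
    reply c nontrivial with respond related c
    ... | c' , translate = answer (any? λ v → 1 ≤? size c' v) wins'
      where
      continue : (φ' : PartialColouring c') → PainterWins G' (uncolouredAfter c' φ') (tokensAfter c') →
                 WinningReply c
      continue φ' wins'' with translate φ'
      ... | φ , related' = φ , go (smaller (tokensAfter-decreases c nontrivial)) related' wins''

      answer : Dec (Nontrivial c') → PainterWins G' U' t' → WinningReply c
      answer (yes (v , nonempty)) (allColoured none) = contradiction (outside c' v (none v)) (>⇒≢ nonempty)
      answer (yes nontrivial')    (round _ moves')   = uncurry continue (moves' c' nontrivial')
      answer (no trivial')        wins'              =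
        continue (noColouring c') (PainterWins-cong (λ v → sym (∧-identityʳ (U' v))) unspent wins')
        where
        unspent : ∀ v → t' v ≡ t' v ∸ size c' v
        unspent v = cong (t' v ∸_) (sym (n<1⇒n≡0 (≰⇒> λ nonempty → trivial' (v , nonempty))))

_⊆ᴳ_ : ∀ {n} → SimpleGraph n → SimpleGraph n → Set
G' ⊆ᴳ G = ∀ {u v} → Adj G' u v ≡ true → Adj G u v ≡ true

module Restriction {n} {G G' : SimpleGraph n} (G'⊆G : G' ⊆ᴳ G) {U t} (c : Cover G U t)
                   (U' : Fin n → Bool) (t' : Fin n → ℕ)
                   {k : Fin n → ℕ} (sublist : ∀ v → Fin (k v) ↣ Fin (size c v)) where

  offered : Fin n → ℕ
  offered v = if U' v then k v ⊓ t' v else 0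

  embed : ∀ v → Fin (offered v) → Fin (size c v)
  embed v i = to (sublist v) (inject≤ i (≤-trans (if-≤ (U' v)) (m⊓n≤m (k v) (t' v))))

  embed-injective : ∀ v {i j} → embed v i ≡ embed v j → i ≡ j
  embed-injective v eq = inject≤-injective _ _ _ _ (injective (sublist v) eq)

  cover : Cover G' U' t'
  cover = record
    { size    = offered
    ; outside = λ v out → cong (λ b → if b then k v ⊓ t' v else 0) out
    ; enough  = λ v → ≤-trans (if-≤ (U' v)) (m⊓n≤n (k v) (t' v))
    ; M       = λ u v a b → M c u v (embed u a) (embed v b)
    ; M-sym   = λ u v a b → M-sym c u v (embed u a) (embed v b)
    ; match₁  = λ u v uv a b b' p q → embed-injective v (match₁ c u v (G'⊆G uv) _ _ _ p q)
    ; match₂  = λ u v uv a a' b p q → embed-injective u (match₂ c u v (G'⊆G uv) _ _ _ p q)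
    }

  lift : PartialColouring cover → (v : Fin n) → Maybe (Fin (size c v))
  lift (φ' , _) v = Maybe.map (embed v) (φ' v)

  lift-proper : (φ' : PartialColouring cover) → ∀ u v → Adj G' u v ≡ true → ∀ a b →
                lift φ' u ≡ just a → lift φ' v ≡ just b → ¬ M c u v a b ≡ true
  lift-proper (φ' , proper) u v uv a b pa pb with map≡just (φ' u) pa | map≡just (φ' v) pb
  ... | a' , φ'u≡a' , refl | b' , φ'v≡b' , refl = proper u v uv a' b' φ'u≡a' φ'v≡b'

  lift-sublist : (φ' : PartialColouring cover) → ∀ v {a} → lift φ' v ≡ just a →
                 ∃ λ i → to (sublist v) i ≡ a
  lift-sublist (φ' , _) v pa with map≡just (φ' v) pa
  ... | i , _ , embed-i≡a = _ , embed-i≡a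

  lift-unoffered : (φ' : PartialColouring cover) → ∀ v → U' v ≡ false → lift φ' v ≡ nothing
  lift-unoffered (φ' , _) v out with φ' v
  ... | nothing = refl
  ... | just i  = ⊥-elim (¬Fin0 (subst Fin (outside cover v out) i))

  uncoloured-lift : (φ' : PartialColouring cover) → ∀ v → U' v ≡ U v →
                    uncolouredAfter cover φ' v ≡ U v ∧ not (isJust (lift φ' v))
  uncoloured-lift (φ' , _) v U'v≡Uv = cong₂ _∧_ U'v≡Uv (cong not (sym (isJust-map (embed v) (φ' v))))

  tokensAfter-cover : ∀ v → U' v ≡ true → tokensAfter cover v ≡ t' v ∸ k v
  tokensAfter-cover v offer = trans (cong (λ b → t' v ∸ (if b then k v ⊓ t' v else 0)) offer)
                                    (m∸[n⊓m]≡m∸n (t' v) (k v))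

record Avoiding {s} (P : Fin s → Set) (r : ℕ) : Set where
  field
    count   : ℕ
    large   : s ≤ count + r
    sublist : Fin count ↣ Fin s
    avoids  : ∀ i → ¬ P (to sublist i)

avoiding : ∀ {s r} {P : Fin s → Set} → Decidable P → (h : ∀ a → P a → Fin r) →
           (∀ {a a'} p p' → h a p ≡ h a' p' → a ≡ a') → Avoiding P r
avoiding {s} {zero} _ h _ = record
  { count = s ; large = ≤-reflexive (sym (+-identityʳ s)) ; sublist = ↣-id _ ; avoids = λ i p → ¬Fin0 (h i p) }
avoiding {zero} {suc r} _ _ _ = record { count = 0 ; large = z≤n ; sublist = ↣-id _ ; avoids = λ () }
avoiding {suc s} {suc r} {P} P? h h-inj with P? zero
... | no ¬p₀ = record
  { count   = suc count
  ; large   = s≤s large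
  ; sublist = mk↣ (lift-injective (to sublist) (injective sublist) 1)
  ; avoids  = λ { zero → ¬p₀ ; (suc i) → avoids i }
  }
  where open Avoiding (avoiding (P? ∘ suc) (h ∘ suc) λ p p' eq → suc-injective (h-inj p p' eq))
... | yes p₀ = record
  { count   = count
  ; large   = ≤-trans (s≤s large) (≤-reflexive (sym (+-suc count r)))
  ; sublist = mk↣ (injective sublist ∘ suc-injective)
  ; avoids  = avoids
  }
  where
  h≢h₀ : ∀ {a} (p : P (suc a)) → h zero p₀ ≢ h (suc a) p
  h≢h₀ p eq = 0≢1+n (h-inj p₀ p eq)
  open Avoiding (avoiding (P? ∘ suc) (λ a p → punchOut (h≢h₀ p))
                  λ p p' eq → suc-injective (h-inj p p' (punchOut-injective (h≢h₀ p) (h≢h₀ p') eq)))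

FewerTokens : ∀ {n} → StateRelation n
FewerTokens U t U' t' = (∀ v → U' v ≡ U v) × (∀ v → U v ≡ true → t' v ≤ t v)

fewerTokens : ∀ {n} (G : SimpleGraph n) → Simulation G G
fewerTokens G = record { Related = FewerTokens ; solvent = solvent ; respond = respond }
  where
  solvent : ∀ {U t U' t'} → FewerTokens U t U' t' → Solvent U' t' → Solvent U t
  solvent (same , fewer) solvent' v u = ≤-trans (solvent' v (trans (same v) u)) (fewer v u)

  respond : ∀ {U t U' t'} → FewerTokens U t U' t' → (c : Cover G U t) → Response G G FewerTokens U' t' c
  respond {U} {t} {U'} {t'} (same , fewer) c =
    cover , λ φ' → (lift φ' , lift-proper φ') , (λ v → uncoloured-lift φ' v (same v)) , fewer-after φ'
    where
    open Restriction (λ uv → uv) c U' t' (λ v → ↣-id _)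
    fewer-after : ∀ φ' v → U v ∧ not (isJust (lift φ' v)) ≡ true → tokensAfter cover v ≤ tokensAfter c v
    fewer-after φ' v uncoloured = begin
      tokensAfter cover v  ≡⟨ tokensAfter-cover v (trans (same v) Uv) ⟩
      t' v ∸ size c v      ≤⟨ ∸-monoˡ-≤ (size c v) (fewer v Uv) ⟩
      t v ∸ size c v       ∎
      where
      open ≤-Reasoning
      Uv : U v ≡ true
      Uv = ∧-conicalˡ (U v) _ uncoloured

module VertexDeletion {n} (G : SimpleGraph n) (x : Fin n) where

  loss : Fin n → ℕ
  loss v = if Adj G x v then 1 else 0

  record Waiting (U : Fin n → Bool) (t : Fin n → ℕ) (U' : Fin n → Bool) (t' : Fin n → ℕ) : Set where
    field
      x-deleted      : U' x ≡ false
      same-elsewhere : ∀ v → v ≢ x → U' v ≡ U v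
      x-uncoloured   : U x ≡ true
      x-solvent      : 1 ≤ t x
      reserve        : ∀ v → v ≢ x → U v ≡ true → t' v ≤ t v ∸ loss v

  Related : StateRelation n
  Related U t U' t' = Waiting U t U' t' ⊎ FewerTokens U t U' t'

  solvent : ∀ {U t U' t'} → Related U t U' t' → Solvent U' t' → Solvent U t
  solvent (inj₂ fewer) = Simulation.solvent (fewerTokens G) fewer
  solvent {t = t} (inj₁ waiting) solvent' v u with v ≟ x
  ... | yes refl = Waiting.x-solvent waiting
  ... | no v≢x   = ≤-trans (solvent' v (trans (Waiting.same-elsewhere waiting v v≢x) u))
                           (≤-trans (Waiting.reserve waiting v v≢x u) (m∸n≤m (t v) (loss v)))

  keepWaiting : ∀ {U t U' t'} → Waiting U t U' t' → (c : Cover G U t) → size c x ≡ 0 →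
                Response G G Related U' t' c
  keepWaiting {U} {t} {U'} {t'} waiting c unoffered =
    cover , λ φ' → (lift φ' , lift-proper φ') , inj₁ record
      { x-deleted      = cong (_∧ not (isJust (proj₁ φ' x))) x-deleted
      ; same-elsewhere = λ v v≢x → uncoloured-lift φ' v (same-elsewhere v v≢x)
      ; x-uncoloured   = trans (cong (λ m → U x ∧ not (isJust m)) (lift-unoffered φ' x x-deleted))
                               (trans (∧-identityʳ (U x)) x-uncoloured)
      ; x-solvent      = subst (λ s → 1 ≤ t x ∸ s) (sym unoffered) x-solvent
      ; reserve        = reserve-after φ'
      }
    where
    open Waiting waiting
    open Restriction (λ uv → uv) c U' t' (λ v → ↣-id _)
    reserve-after : ∀ φ' v → v ≢ x → U v ∧ not (isJust (lift φ' v)) ≡ true →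
                    tokensAfter cover v ≤ tokensAfter c v ∸ loss v
    reserve-after φ' v v≢x uncoloured = begin
      tokensAfter cover v        ≡⟨ tokensAfter-cover v (trans (same-elsewhere v v≢x) Uv) ⟩
      t' v ∸ size c v            ≤⟨ m≤n∸r⇒m∸k≤n∸o (size c v) (reserve v v≢x Uv) ≤-refl ⟩
      t v ∸ (size c v + loss v)  ≡⟨ ∸-+-assoc (t v) (size c v) (loss v) ⟨
      t v ∸ size c v ∸ loss v    ∎
      where
      open ≤-Reasoning
      Uv : U v ≡ true
      Uv = ∧-conicalˡ (U v) _ uncoloured

  colourX : ∀ {U t U' t'} → Waiting U t U' t' → (c : Cover G U t) → Fin (size c x) →
            Response G G Related U' t' c
  colourX {U} {t} {U'} {t'} waiting c a₀ =
    cover , λ φ' → (colour φ' , proper φ') , inj₂ (same φ' , fewer φ')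
    where
    open Waiting waiting

    -- M c x v is unconstrained when xv is not an edge, hence the adjacency conjunct.
    Conflict : ∀ v → Fin (size c v) → Set
    Conflict v β = Adj G x v ≡ true × M c x v a₀ β ≡ true

    avoid : ∀ v → Avoiding (Conflict v) (loss v)
    avoid v = avoiding (λ β → (Adj G x v Bool.≟ true) ×-dec (M c x v a₀ β Bool.≟ true))
                       (λ _ (xv , _) → subst (λ b → Fin (if b then 1 else 0)) (sym xv) zero)
                       (λ (xv , m) (_ , m') _ → match₁ c x v xv a₀ _ _ m m')

    open Restriction (λ uv → uv) c U' t' (Avoiding.sublist ∘ avoid)

    colourAt : PartialColouring cover → (v : Fin n) → Dec (v ≡ x) → Maybe (Fin (size c v))
    colourAt φ' v (yes refl) = just a₀
    colourAt φ' v (no _)     = lift φ' v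

    colour : PartialColouring cover → (v : Fin n) → Maybe (Fin (size c v))
    colour φ' v = colourAt φ' v (v ≟ x)

    a₀-unblocked : ∀ φ' v → Adj G x v ≡ true → ∀ {β} → lift φ' v ≡ just β → ¬ M c x v a₀ β ≡ true
    a₀-unblocked φ' v xv pβ m with lift-sublist φ' v pβ
    ... | i , refl = Avoiding.avoids (avoid v) i (xv , m)

    proper : ∀ φ' u v → Adj G u v ≡ true → ∀ α β →
             colour φ' u ≡ just α → colour φ' v ≡ just β → ¬ M c u v α β ≡ true
    proper φ' u v uv α β pu pv with u ≟ x | v ≟ x
    ... | yes refl | yes refl = contradiction (trans (sym uv) (irrefl G x)) λ ()
    ... | yes refl | no _ with refl ← pu = a₀-unblocked φ' v uv pv
    ... | no _ | yes refl with refl ← pv =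
      a₀-unblocked φ' u (trans (SimpleGraph.sym G x u) uv) pu ∘ trans (M-sym c x u a₀ α)
    ... | no _ | no _ = lift-proper φ' u v uv α β pu pv

    same : ∀ φ' v → uncolouredAfter cover φ' v ≡ U v ∧ not (isJust (colour φ' v))
    same φ' v with v ≟ x
    ... | yes refl = trans (cong (_∧ not (isJust (proj₁ φ' x))) x-deleted) (sym (∧-zeroʳ (U x)))
    ... | no v≢x   = uncoloured-lift φ' v (same-elsewhere v v≢x)

    fewer : ∀ φ' v → U v ∧ not (isJust (colour φ' v)) ≡ true → tokensAfter cover v ≤ tokensAfter c v
    fewer φ' v uncoloured with v ≟ x
    ... | yes refl = contradiction (trans (sym (∧-zeroʳ (U x))) uncoloured) λ ()
    ... | no v≢x   = begin
      tokensAfter cover v              ≡⟨ tokensAfter-cover v (trans (same-elsewhere v v≢x) Uv) ⟩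
      t' v ∸ Avoiding.count (avoid v)  ≤⟨ m≤n∸r⇒m∸k≤n∸o {r = loss v} _ (reserve v v≢x Uv) (Avoiding.large (avoid v)) ⟩
      t v ∸ size c v                   ∎
      where
      open ≤-Reasoning
      Uv : U v ≡ true
      Uv = ∧-conicalˡ (U v) _ uncoloured

  respond : ∀ {U t U' t'} → Related U t U' t' → (c : Cover G U t) → Response G G Related U' t' c
  respond (inj₂ fewer) c with Simulation.respond (fewerTokens G) fewer c
  ... | c' , translate = c' , map₂ inj₂ ∘ translate
  respond (inj₁ waiting) c with size c x in |L[x]|
  ... | zero  = keepWaiting waiting c |L[x]|
  ... | suc _ = colourX waiting c (subst Fin (sym |L[x]|) zero)

  simulation : Simulation G G
  simulation = record { Related = Related ; solvent = solvent ; respond = respond }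

deleteEdge : ∀ {n} → SimpleGraph n → Fin n → Fin n → SimpleGraph n
deleteEdge G x y = record
  { Adj    = delEdge (Adj G) x y
  ; sym    = λ u v → cong₂ _∧_ (SimpleGraph.sym G u v) (cong not (swap u v))
  ; irrefl = λ v → cong (_∧ _) (irrefl G v)
  }
  where
  swap : ∀ u v → ((u == x) ∧ (v == y)) ∨ ((u == y) ∧ (v == x)) ≡ ((v == x) ∧ (u == y)) ∨ ((v == y) ∧ (u == x))
  swap u v = trans (cong₂ _∨_ (∧-comm (u == x) (v == y)) (∧-comm (u == y) (v == x)))
                   (∨-comm ((v == y) ∧ (u == x)) ((v == x) ∧ (u == y)))

deleteEdge-⊆ : ∀ {n} (G : SimpleGraph n) x y → deleteEdge G x y ⊆ᴳ G
deleteEdge-⊆ G x y {u} {v} = ∧-conicalˡ (Adj G u v) _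

deleteEdge-removed : ∀ {n} (G : SimpleGraph n) {x y u v} → Adj G u v ≡ true →
                     Adj (deleteEdge G x y) u v ≡ false → (u ≡ x × v ≡ y) ⊎ (u ≡ y × v ≡ x)
deleteEdge-removed G {x} {y} {u} {v} uv removed
  with ∨-∧-true (u == x) (v == y) (u == y) (v == x) (not-injective (trans (cong (_∧ _) (sym uv)) removed))
... | inj₁ (u≡x , v≡y) = inj₁ (==⇒≡ u≡x , ==⇒≡ v≡y)
... | inj₂ (u≡y , v≡x) = inj₂ (==⇒≡ u≡y , ==⇒≡ v≡x)

module EdgeDeletion {n} (G : SimpleGraph n) {x y : Fin n} (xy : Adj G x y ≡ true) where

  G' : SimpleGraph n
  G' = deleteEdge G x y

  tokensOfY : (Fin n → Bool) → (Fin n → ℕ) → ℕ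
  tokensOfY U t = if U y then t y else 0

  record Related (U : Fin n → Bool) (t : Fin n → ℕ) (U' : Fin n → Bool) (t' : Fin n → ℕ) : Set where
    field
      same            : ∀ v → U' v ≡ U v
      fewer-elsewhere : ∀ v → v ≢ x → U v ≡ true → t' v ≤ t v
      -- Once the simulated x is out of tokens the simulated Painter has lost, so the reserve may lapse.
      x-reserve       : U x ≡ true → 1 ≤ t' x → t' x + tokensOfY U t ≤ t x

  solvent : ∀ {U t U' t'} → Related U t U' t' → Solvent U' t' → Solvent U t
  solvent {U} {t} {U'} {t'} related solvent' v u with v ≟ x
  ... | yes refl = ≤-trans t'x≥1 (≤-trans (m≤m+n (t' x) _) (Related.x-reserve related u t'x≥1))
    where
    t'x≥1 : 1 ≤ t' x
    t'x≥1 = solvent' x (trans (Related.same related x) u)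
  ... | no v≢x   = ≤-trans (solvent' v (trans (Related.same related v) u))
                           (Related.fewer-elsewhere related v v≢x u)

  respond : ∀ {U t U' t'} → Related U t U' t' → (c : Cover G U t) → Response G G' Related U' t' c
  respond {U} {t} {U'} {t'} related c = cover , λ φ' → (lift φ' , proper φ') , record
    { same            = λ v → uncoloured-lift φ' v (same v)
    ; fewer-elsewhere = fewer-after φ'
    ; x-reserve       = x-reserve-after φ'
    }
    where
    open Related related

    Conflict : Fin (size c x) → Set
    Conflict α = ∃ λ β → M c x y α β ≡ true

    avoid : Avoiding Conflict (size c y)
    avoid = avoiding (λ α → any? λ β → M c x y α β Bool.≟ true) (λ _ → proj₁)
                     λ { (β , m) (_ , m') refl → match₂ c x y xy _ _ β m m' }

    sublistAt : ∀ v → Dec (v ≡ x) → Σ ℕ λ k → Fin k ↣ Fin (size c v)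
    sublistAt v (yes refl) = Avoiding.count avoid , Avoiding.sublist avoid
    sublistAt v (no _)     = size c v , ↣-id _

    open Restriction (deleteEdge-⊆ G x y) c U' t' (λ v → proj₂ (sublistAt v (v ≟ x)))

    kept : Fin n → ℕ
    kept v = proj₁ (sublistAt v (v ≟ x))

    x-large : (d : Dec (x ≡ x)) → size c x ≤ proj₁ (sublistAt x d) + size c y
    x-large (yes refl) = Avoiding.large avoid
    x-large (no x≢x)   = contradiction refl x≢x

    x-avoids : (d : Dec (x ≡ x)) → ∀ i β → ¬ M c x y (to (proj₂ (sublistAt x d)) i) β ≡ true
    x-avoids (yes refl) i β m = Avoiding.avoids avoid i (β , m)
    x-avoids (no x≢x)         = contradiction refl x≢x

    all-elsewhere : ∀ {v} → v ≢ x → (d : Dec (v ≡ x)) → size c v ≤ proj₁ (sublistAt v d)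
    all-elsewhere v≢x (yes v≡x) = contradiction v≡x v≢x
    all-elsewhere v≢x (no _)    = ≤-refl

    lift-x-avoids-y : ∀ φ' {α} → lift φ' x ≡ just α → ∀ β → ¬ M c x y α β ≡ true
    lift-x-avoids-y φ' pα β with lift-sublist φ' x pα
    ... | i , refl = x-avoids (x ≟ x) i β

    proper : ∀ φ' u v → Adj G u v ≡ true → ∀ α β →
             lift φ' u ≡ just α → lift φ' v ≡ just β → ¬ M c u v α β ≡ true
    proper φ' u v uv α β pu pv with Adj G' u v in uv∈G'
    ... | true  = lift-proper φ' u v uv∈G' α β pu pv
    ... | false with deleteEdge-removed G uv uv∈G'
    ...   | inj₁ (refl , refl) = lift-x-avoids-y φ' pu β
    ...   | inj₂ (refl , refl) = lift-x-avoids-y φ' pv α ∘ trans (M-sym c x y β α)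

    fewer-after : ∀ φ' v → v ≢ x → U v ∧ not (isJust (lift φ' v)) ≡ true →
                  tokensAfter cover v ≤ tokensAfter c v
    fewer-after φ' v v≢x uncoloured = begin
      tokensAfter cover v  ≡⟨ tokensAfter-cover v (trans (same v) Uv) ⟩
      t' v ∸ kept v        ≤⟨ ∸-monoʳ-≤ (t' v) (all-elsewhere v≢x (v ≟ x)) ⟩
      t' v ∸ size c v      ≤⟨ ∸-monoˡ-≤ (size c v) (fewer-elsewhere v v≢x Uv) ⟩
      t v ∸ size c v       ∎
      where
      open ≤-Reasoning
      Uv : U v ≡ true
      Uv = ∧-conicalˡ (U v) _ uncoloured

    size≤tokensOfY : size c y ≤ (if U y then t y else 0)
    size≤tokensOfY with U y in Uy
    ... | true  = enough c y
    ... | false = ≤-reflexive (outside c y Uy)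

    x-reserve-after : ∀ φ' → U x ∧ not (isJust (lift φ' x)) ≡ true → 1 ≤ tokensAfter cover x →
                      tokensAfter cover x + tokensOfY (uncolouredAfter c (lift φ' , proper φ')) (tokensAfter c)
                        ≤ tokensAfter c x
    x-reserve-after φ' uncoloured positive = begin
      tokensAfter cover x + Y'                     ≡⟨ cong (_+ Y') spent ⟩
      t' x ∸ kept x + Y'                           ≤⟨ +-monoʳ-≤ (t' x ∸ kept x) Y'≤ ⟩
      t' x ∸ kept x + (tokensOfY U t ∸ size c y)   ≡⟨ m∸n+[o∸p]≡m+o∸[n+p] kept≤t'x size≤tokensOfY ⟩
      t' x + tokensOfY U t ∸ (kept x + size c y)   ≤⟨ ∸-monoˡ-≤ (kept x + size c y) (x-reserve Ux (≤-trans positive' (m∸n≤m (t' x) (kept x)))) ⟩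
      t x ∸ (kept x + size c y)                    ≤⟨ ∸-monoʳ-≤ (t x) (x-large (x ≟ x)) ⟩
      t x ∸ size c x                               ∎
      where
      open ≤-Reasoning
      Ux : U x ≡ true
      Ux = ∧-conicalˡ (U x) _ uncoloured
      spent : tokensAfter cover x ≡ t' x ∸ kept x
      spent = tokensAfter-cover x (trans (same x) Ux)
      positive' : 1 ≤ t' x ∸ kept x
      positive' = subst (1 ≤_) spent positive
      kept≤t'x : kept x ≤ t' x
      kept≤t'x = <⇒≤ (m∸n≢0⇒n<m (>⇒≢ positive'))
      Y' : ℕ
      Y' = tokensOfY (uncolouredAfter c (lift φ' , proper φ')) (tokensAfter c)
      Y'≤ : Y' ≤ tokensOfY U t ∸ size c y
      Y'≤ = if-∧-∸-≤ (U y) _ (t y) (size c y)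

  simulation : Simulation G G'
  simulation = record { Related = Related ; solvent = solvent ; respond = respond }

WStar⇒PainterWins : ∀ {n} (G : SimpleGraph n) {alive f} → WStar alive (Adj G) f → PainterWins G alive f
WStar⇒PainterWins G (empty none) = allColoured none
WStar⇒PainterWins G {alive} {f} (reduceValue x s _ _ _ w) =
  simulate (fewerTokens G) ((λ _ → refl) , fewer) (WStar⇒PainterWins G w)
  where
  fewer : ∀ v → alive v ≡ true → upd f x (f x ∸ s) v ≤ f v
  fewer v _ with v ≟ x
  ... | yes refl = m∸n≤m (f x) s
  ... | no _     = ≤-refl
WStar⇒PainterWins G {alive} {f} (edgeDelete x y _ alive-y xy y<x w) =
  simulate (EdgeDeletion.simulation G xy) record
    { same            = λ _ → refl
    ; fewer-elsewhere = λ v v≢x _ → ≤-reflexive (upd-≢ f x _ v≢x)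
    ; x-reserve       = λ _ _ → ≤-reflexive x-pays
    }
    (WStar⇒PainterWins (deleteEdge G x y) w)
  where
  x-pays : upd f x (f x ∸ f y) x + (if alive y then f y else 0) ≡ f x
  x-pays rewrite upd-≡ f x (f x ∸ f y) | alive-y = m∸n+n≡m (<⇒≤ y<x)
WStar⇒PainterWins G {alive} {f} (vertexDelete x alive-x fx>0 w) =
  simulate (VertexDeletion.simulation G x) (inj₁ record
    { x-deleted      = upd-≡ alive x false
    ; same-elsewhere = λ v v≢x → upd-≢ alive x false v≢x
    ; x-uncoloured   = alive-x
    ; x-solvent      = fx>0
    ; reserve        = reserve
    })
    (WStar⇒PainterWins G w)
  where
  reserve : ∀ v → v ≢ x → alive v ≡ true →
            (if alive v ∧ Adj G x v then f v ∸ 1 else f v) ≤ f v ∸ VertexDeletion.loss G x v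
  reserve v _ alive-v rewrite alive-v with Adj G x v
  ... | true  = ≤-refl
  ... | false = ≤-refl

corollary1 : (n : ℕ) (G : SimpleGraph n) →
    ((f : Fin n → ℕ) → WeakStarDegenerate G f → DPPaintable G f) ×
    (∀ d k → IsWdStar G d → IsChiDPP G k → k ≤ d)
corollary1 n G = (λ f → WStar⇒PainterWins G) ,
                 λ d k (d-degenerate , _) (_ , k-least) → k-least d (WStar⇒PainterWins G d-degenerate)
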